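{- Let $\Sigma$ be an oriented graph with $\det W(\Sigma)\neq 0$. Then there exists a unique regular rational orthogonal matrix $Q_0\in\mathcal{Q}(\Sigma)$ such that $Q_0^{\rm T}S(\Sigma)Q_0=S(\Sigma^{\rm T})$. Moreover, if $\Sigma$ is not self-converse, then $Q_0$ is not a permutation matrix.
   Context: An oriented graph $\Sigma$ on vertices $v_1,\dots,v_n$ is a simple graph with each edge given a direction. Its skew-adjacency matrix $S(\Sigma)=(s_{ij})$ has $s_{ij}=1$ if $(v_i,v_j)$ is an arc, $s_{ij}=-1$ if $(v_j,v_i)$ is an arc, and $0$ otherwise. The converse $\Sigma^{\rm T}$ is obtained by reversing every arc, so $S(\Sigma^{\rm T})=-S(\Sigma)$; $\Sigma$ is self-converse if it is isomorphic to $\Sigma^{\rm T}$ (isomorphism: $P^{\rm T}S(\Sigma)P=S(\Sigma^{\rm T})$ for a permutation matrix $P$). Two oriented graphs are generalized cospectral if their skew-adjacency matrices $S$ have the same spectrum and the matrices $J-I-S$ have the same spectrum ($J$ all-one). $W(\Sigma)=[e,Se,\dots,S^{n-1}e]$ with $S=S(\Sigma)$, $e$ the all-one vector. A rational orthogonal matrix $Q$ is regular if $Qe=e$. $\mathcal{Q}(\Sigma)$ is the set of regular rational orthogonal matrices $Q$ such that $Q^{\rm T}S(\Sigma)Q=S(\Delta)$ for some oriented graph $\Delta$ generalized cospectral with $\Sigma$. -}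

module Defs where

open import Data.Nat using (ℕ; zero; suc)
open import Data.Fin using (Fin; zero; suc; punchIn; _≟_)
open import Data.Fin.Permutation using (Permutation′; _⟨$⟩ʳ_)
open import Data.Bool using (Bool; true; false; if_then_else_)
open import Data.Rational using (ℚ; 0ℚ; 1ℚ; _+_; _*_; -_; _-_)
open import Data.Product using (Σ; ∃; _×_; _,_)
open import Relation.Binary.PropositionalEquality using (_≡_)
open import Relation.Nullary using (¬_; does)

Mat : ℕ → Set
Mat n = Fin n → Fin n → ℚ

Vect : ℕ → Set
Vect n = Fin n → ℚ

sumF : ∀ {n} → (Fin n → ℚ) → ℚ
sumF {zero}  f = 0ℚ
sumF {suc n} f = f zero + sumF (λ i → f (suc i))

_⊗_ : ∀ {n} → Mat n → Mat n → Mat n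
(A ⊗ B) i j = sumF (λ k → A i k * B k j)

_⊛_ : ∀ {n} → Mat n → Vect n → Vect n
(A ⊛ v) i = sumF (λ k → A i k * v k)

transpose : ∀ {n} → Mat n → Mat n
transpose A i j = A j i

δ : ∀ {n} → Fin n → Fin n → ℚ
δ i j = if does (i ≟ j) then 1ℚ else 0ℚ

idM : ∀ {n} → Mat n
idM = δ

allOnesM : ∀ {n} → Mat n
allOnesM _ _ = 1ℚ

e : ∀ {n} → Vect n
e _ = 1ℚ

_⊖_ : ∀ {n} → Mat n → Mat n → Mat n
(A ⊖ B) i j = A i j - B i j

scal : ∀ {n} → ℚ → Mat n → Mat n
scal t A i j = t * A i j

_≐_ : ∀ {n} → Mat n → Mat n → Set
A ≐ B = ∀ i j → A i j ≡ B i j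

sign : ℕ → ℚ
sign zero = 1ℚ
sign (suc zero) = - 1ℚ
sign (suc (suc k)) = sign k

toℕ' : ∀ {n} → Fin n → ℕ
toℕ' zero = zero
toℕ' (suc i) = suc (toℕ' i)

det : ∀ {n} → Mat n → ℚ
det {zero}  A = 1ℚ
det {suc n} A = sumF (λ j → sign (toℕ' j) * (A zero j * det (λ a b → A (suc a) (punchIn j b))))

_^^_ : ∀ {n} → Mat n → ℕ → Mat n
A ^^ zero = idM
A ^^ suc k = A ⊗ (A ^^ k)

-- Oriented graphs on vertex set Fin n: arc i j = true iff (v_i, v_j) is an arc
record OrientedGraph (n : ℕ) : Set where
  field
    arc   : Fin n → Fin n → Bool
    irrefl : ∀ i → arc i i ≡ false
    asym   : ∀ i j → arc i j ≡ true → arc j i ≡ false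
open OrientedGraph public

S : ∀ {n} → OrientedGraph n → Mat n
S Γ i j = if arc Γ i j then 1ℚ else (if arc Γ j i then - 1ℚ else 0ℚ)

converse : ∀ {n} → OrientedGraph n → OrientedGraph n
converse Γ = record
  { arc = λ i j → arc Γ j i
  ; irrefl = λ i → irrefl Γ i
  ; asym = λ i j h → asym Γ j i h }

W : ∀ {n} → OrientedGraph n → Mat n
W Γ i k = ((S Γ ^^ toℕ' k) ⊛ e) i

permMat : ∀ {n} → Permutation′ n → Mat n
permMat σ i j = δ (σ ⟨$⟩ʳ i) j

IsPermutationMatrix : ∀ {n} → Mat n → Set
IsPermutationMatrix {n} Q = Σ (Permutation′ n) (λ σ → Q ≐ permMat σ)

SelfConverse : ∀ {n} → OrientedGraph n → Set
SelfConverse {n} Γ = Σ (Permutation′ n) (λ σ →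
  (transpose (permMat σ) ⊗ (S Γ ⊗ permMat σ)) ≐ S (converse Γ))

Orthogonal : ∀ {n} → Mat n → Set
Orthogonal Q = (transpose Q ⊗ Q) ≐ idM

Regular : ∀ {n} → Mat n → Set
Regular Q = ∀ i → (Q ⊛ e) i ≡ e i

-- same spectrum: equal characteristic polynomials det(tI - A), compared
-- as polynomial functions on ℚ (equivalent to polynomial equality since ℚ is infinite)
Cospectral : ∀ {n} → Mat n → Mat n → Set
Cospectral A B = ∀ t → det (scal t idM ⊖ A) ≡ det (scal t idM ⊖ B)

GenCospectral : ∀ {n} → OrientedGraph n → OrientedGraph n → Set
GenCospectral Γ Δ =
  Cospectral (S Γ) (S Δ) ×
  Cospectral ((allOnesM ⊖ idM) ⊖ S Γ) ((allOnesM ⊖ idM) ⊖ S Δ)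

InQ : ∀ {n} → OrientedGraph n → Mat n → Set
InQ {n} Γ Q = Orthogonal Q × Regular Q ×
  ∃ (λ (Δ : OrientedGraph n) → GenCospectral Γ Δ × ((transpose Q ⊗ (S Γ ⊗ Q)) ≐ S Δ))

-- Write W = [x, Sx, …, Sⁿ⁻¹x] with x = e and D = diag (1, -1, 1, …). Since S is
-- skew-symmetric, ⟨Sⁱx, Sʲx⟩ = (-1)ⁱ ⟨x, Sⁱ⁺ʲx⟩ vanishes whenever i + j is odd; hence
-- D WᵀW D = WᵀW, and Q₀ = W D W⁻¹ is a symmetric orthogonal involution. The same parity
-- argument gives Q₀ Sⁿx = (-1)ⁿ Sⁿx, so Q₀ S W = -S Q₀ W, i.e. Q₀ S Q₀ = -S, and Q₀ e = e.
-- Conversely, if Q is orthogonal with Q e = e and QᵀSQ = -S, then Qᵀ S = -S Qᵀ, so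
-- Qᵀ Sᵏe = (-1)ᵏ Sᵏe, i.e. QᵀW = W D = Q₀ W, which forces Q = Q₀. A permutation matrix Q₀
-- would witness that Σ is self-converse.

module Submission where

open import Defs
open import Level using (0ℓ)
open import Data.Bool using (true; false; if_then_else_)
open import Data.Empty using (⊥-elim)
open import Data.Product using (Σ; Σ-syntax; _×_; _,_; proj₁; proj₂)
open import Data.Sum using (_⊎_; inj₁; inj₂)
open import Data.Nat as ℕ using (ℕ; zero; suc)
import Data.Nat.Properties as ℕP
open import Data.Fin as Fin using (Fin; zero; suc; punchIn)
open import Data.Fin.Induction using (<-weakInduction)
import Data.Fin.Properties as FinP
open import Data.Rational as ℚ using (ℚ; 0ℚ; 1ℚ; ½; _+_; _*_; -_; _-_)
import Data.Rational.Properties as ℚP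
open import Data.Rational.Solver using (module +-*-Solver)
open +-*-Solver
open import Algebra.Bundles using (CommutativeRing)
open import Algebra.Properties.Group ℚP.+-0-group using (x∙y⁻¹≈ε⇒x≈y)
import Algebra.Properties.Semiring.Sum as SemiringSum
open import Relation.Binary.Bundles using (Setoid)
import Relation.Binary.Reasoning.Setoid as SetoidReasoning
open import Relation.Binary.PropositionalEquality
open import Relation.Nullary using (¬_; Dec; does; yes; no)
open import Relation.Nullary.Decidable using (dec-true; dec-false)

-- Finite sums

private
  module Σℚ = SemiringSum (CommutativeRing.semiring ℚP.+-*-commutativeRing)

  sumF≡sum : ∀ {n} (f : Fin n → ℚ) → sumF f ≡ Σℚ.sum f
  sumF≡sum {zero}  f = refl
  sumF≡sum {suc n} f = cong (f zero +_) (sumF≡sum (λ i → f (suc i)))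

sumF-cong : ∀ {n} {f g : Fin n → ℚ} → (∀ i → f i ≡ g i) → sumF f ≡ sumF g
sumF-cong {zero}  f≗g = refl
sumF-cong {suc n} f≗g = cong₂ _+_ (f≗g zero) (sumF-cong (λ i → f≗g (suc i)))

sumF-zero : ∀ {n} {f : Fin n → ℚ} → (∀ i → f i ≡ 0ℚ) → sumF f ≡ 0ℚ
sumF-zero {zero}  f≗0 = refl
sumF-zero {suc n} f≗0 = cong₂ _+_ (f≗0 zero) (sumF-zero (λ i → f≗0 (suc i)))

module _ {n : ℕ} where

  sumF-+ : (f g : Fin n → ℚ) → sumF (λ i → f i + g i) ≡ sumF f + sumF g
  sumF-+ f g = trans (sumF≡sum (λ i → f i + g i))
    (trans (Σℚ.∑-distrib-+ f g) (sym (cong₂ _+_ (sumF≡sum f) (sumF≡sum g))))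

  *-distribˡ-sumF : (c : ℚ) (f : Fin n → ℚ) → c * sumF f ≡ sumF (λ i → c * f i)
  *-distribˡ-sumF c f = trans (cong (c *_) (sumF≡sum f))
    (trans (Σℚ.*-distribˡ-sum c f) (sym (sumF≡sum (λ i → c * f i))))

  *-distribʳ-sumF : (c : ℚ) (f : Fin n → ℚ) → sumF f * c ≡ sumF (λ i → f i * c)
  *-distribʳ-sumF c f = trans (cong (_* c) (sumF≡sum f))
    (trans (Σℚ.*-distribʳ-sum c f) (sym (sumF≡sum (λ i → f i * c))))

*-distribˡ-sumF² : ∀ {n} (c a : ℚ) (f : Fin n → ℚ) → c * (a * sumF f) ≡ sumF (λ k → c * (a * f k))
*-distribˡ-sumF² c a f = trans (cong (c *_) (*-distribˡ-sumF a f)) (*-distribˡ-sumF c (λ k → a * f k))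

neg-sumF : ∀ {n} (f : Fin n → ℚ) → - sumF f ≡ sumF (λ i → - f i)
neg-sumF {zero}  f = refl
neg-sumF {suc n} f = trans (ℚP.neg-distrib-+ (f zero) _) (cong (- f zero +_) (neg-sumF (λ i → f (suc i))))

sumF-- : ∀ {n} (f g : Fin n → ℚ) → sumF (λ i → f i - g i) ≡ sumF f - sumF g
sumF-- f g = trans (sumF-+ f (λ i → - g i)) (cong (sumF f +_) (sym (neg-sumF g)))

sumF-comm : ∀ {m n} (f : Fin m → Fin n → ℚ) →
  sumF (λ i → sumF (λ j → f i j)) ≡ sumF (λ j → sumF (λ i → f i j))
sumF-comm f = trans (sumF²≡sum² f) (trans (Σℚ.∑-comm f) (sym (sumF²≡sum² (λ j i → f i j))))
  where
  sumF²≡sum² : ∀ {m n} (g : Fin m → Fin n → ℚ) → sumF (λ i → sumF (g i)) ≡ Σℚ.sum (λ i → Σℚ.sum (g i))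
  sumF²≡sum² g = trans (sumF≡sum (λ i → sumF (g i))) (Σℚ.sum-cong-≗ (λ i → sumF≡sum (g i)))

-- Signs and the Kronecker delta

sign-suc : ∀ m → sign (suc m) ≡ - sign m
sign-suc zero          = refl
sign-suc (suc zero)    = refl
sign-suc (suc (suc m)) = sign-suc m

sign-sq : ∀ m → sign m * sign m ≡ 1ℚ
sign-sq zero          = refl
sign-sq (suc zero)    = refl
sign-sq (suc (suc m)) = sign-sq m

x≡-x⇒x≡0 : ∀ {x} → x ≡ - x → x ≡ 0ℚ
x≡-x⇒x≡0 {x} x≡-x = begin
  x                 ≡⟨ solve 1 (λ x → x := con ½ :* (x :+ x)) refl x ⟩
  ½ * (x + x)       ≡⟨ cong (λ y → ½ * (x + y)) x≡-x ⟩
  ½ * (x + - x)     ≡⟨ solve 1 (λ x → con ½ :* (x :+ :- x) := con 0ℚ) refl x ⟩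
  0ℚ                ∎
  where open ≡-Reasoning

sgn : ∀ {n} → Fin n → ℚ
sgn k = sign (toℕ' k)

toℕ'≡toℕ : ∀ {n} (i : Fin n) → toℕ' i ≡ Fin.toℕ i
toℕ'≡toℕ zero    = refl
toℕ'≡toℕ (suc i) = cong suc (toℕ'≡toℕ i)

toℕ'<n : ∀ {n} (i : Fin n) → toℕ' i ℕ.< n
toℕ'<n i = subst (ℕ._< _) (sym (toℕ'≡toℕ i)) (FinP.toℕ<n i)

δ-refl : ∀ {n} (i : Fin n) → δ i i ≡ 1ℚ
δ-refl i = cong (if_then 1ℚ else 0ℚ) (dec-true (i Fin.≟ i) refl)

δ-≢ : ∀ {n} {i j : Fin n} → i ≢ j → δ i j ≡ 0ℚ
δ-≢ {i = i} {j} i≢j = cong (if_then 1ℚ else 0ℚ) (dec-false (i Fin.≟ j) i≢j)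

δ-sym : ∀ {n} (i j : Fin n) → δ i j ≡ δ j i
δ-sym i j = by-cases (i Fin.≟ j)
  where
  by-cases : Dec (i ≡ j) → δ i j ≡ δ j i
  by-cases (yes i≡j) = cong₂ δ i≡j (sym i≡j)
  by-cases (no i≢j)  = trans (δ-≢ i≢j) (sym (δ-≢ (λ j≡i → i≢j (sym j≡i))))

δ-suc : ∀ {n} (i j : Fin n) → δ (suc i) (suc j) ≡ δ i j
δ-suc i j with i Fin.≟ j
... | yes _ = refl
... | no _  = refl

sumF-δʳ : ∀ {n} (f : Fin n → ℚ) (k : Fin n) → sumF (λ j → f j * δ j k) ≡ f k
sumF-δʳ f zero = begin
  f zero * 1ℚ + sumF (λ j → f (suc j) * 0ℚ)
    ≡⟨ cong₂ _+_ (ℚP.*-identityʳ (f zero)) (sumF-zero (λ j → ℚP.*-zeroʳ (f (suc j)))) ⟩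
  f zero + 0ℚ
    ≡⟨ ℚP.+-identityʳ (f zero) ⟩
  f zero  ∎
  where open ≡-Reasoning
sumF-δʳ f (suc k) = begin
  f zero * 0ℚ + sumF (λ j → f (suc j) * δ (suc j) (suc k))
    ≡⟨ cong₂ _+_ (ℚP.*-zeroʳ (f zero)) (sumF-cong (λ j → cong (f (suc j) *_) (δ-suc j k))) ⟩
  0ℚ + sumF (λ j → f (suc j) * δ j k)
    ≡⟨ ℚP.+-identityˡ _ ⟩
  sumF (λ j → f (suc j) * δ j k)
    ≡⟨ sumF-δʳ (λ j → f (suc j)) k ⟩
  f (suc k)  ∎
  where open ≡-Reasoning

sumF-δˡ : ∀ {n} (f : Fin n → ℚ) (k : Fin n) → sumF (λ j → δ k j * f j) ≡ f k
sumF-δˡ f k = trans (sumF-cong (λ j → trans (ℚP.*-comm (δ k j) (f j)) (cong (f j *_) (δ-sym k j)))) (sumF-δʳ f k)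

-- Matrix algebra

≐-setoid : ℕ → Setoid 0ℓ 0ℓ
≐-setoid n = record
  { Carrier       = Mat n
  ; _≈_           = _≐_
  ; isEquivalence = record
    { refl  = λ i j → refl
    ; sym   = λ A≐B i j → sym (A≐B i j)
    ; trans = λ A≐B B≐C i j → trans (A≐B i j) (B≐C i j)
    }
  }

module _ {n : ℕ} where
  open Setoid (≐-setoid n) public using () renaming (refl to ≐-refl; sym to ≐-sym; trans to ≐-trans)

module ≐-Reasoning {n : ℕ} = SetoidReasoning (≐-setoid n)

-ᴹ_ : ∀ {n} → Mat n → Mat n
(-ᴹ A) i j = - A i j

diag : ∀ {n} → Vect n → Mat n
diag d i j = d i * δ i j

dot : ∀ {n} → Vect n → Vect n → ℚ
dot x y = sumF (λ k → x k * y k)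

module _ {n : ℕ} where

  ⊛-cong : {A B : Mat n} {u v : Vect n} → A ≐ B → u ≗ v → (A ⊛ u) ≗ (B ⊛ v)
  ⊛-cong A≐B u≗v i = sumF-cong (λ k → cong₂ _*_ (A≐B i k) (u≗v k))

  ⊛-congˡ : {A B : Mat n} (v : Vect n) → A ≐ B → (A ⊛ v) ≗ (B ⊛ v)
  ⊛-congˡ v A≐B = ⊛-cong {u = v} A≐B (λ _ → refl)

  ⊛-congʳ : (A : Mat n) {u v : Vect n} → u ≗ v → (A ⊛ u) ≗ (A ⊛ v)
  ⊛-congʳ A = ⊛-cong (≐-refl {x = A})

  ⊛-assoc : (A B : Mat n) (v : Vect n) → ((A ⊗ B) ⊛ v) ≗ (A ⊛ (B ⊛ v))
  ⊛-assoc A B v i = begin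
    sumF (λ k → sumF (λ l → A i l * B l k) * v k)    ≡⟨ sumF-cong (λ k → *-distribʳ-sumF (v k) (λ l → A i l * B l k)) ⟩
    sumF (λ k → sumF (λ l → A i l * B l k * v k))    ≡⟨ sumF-comm (λ k l → A i l * B l k * v k) ⟩
    sumF (λ l → sumF (λ k → A i l * B l k * v k))    ≡⟨ sumF-cong (λ l → sumF-cong (λ k → ℚP.*-assoc (A i l) (B l k) (v k))) ⟩
    sumF (λ l → sumF (λ k → A i l * (B l k * v k)))  ≡⟨ sumF-cong (λ l → *-distribˡ-sumF (A i l) (λ k → B l k * v k)) ⟨
    sumF (λ l → A i l * sumF (λ k → B l k * v k))    ∎
    where open ≡-Reasoning

  ⊛-identityˡ : (v : Vect n) → (idM ⊛ v) ≗ v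
  ⊛-identityˡ v i = sumF-δˡ v i

  ⊛-scale : (A : Mat n) (c : ℚ) (v : Vect n) → (A ⊛ (λ j → c * v j)) ≗ (λ i → c * (A ⊛ v) i)
  ⊛-scale A c v i = trans (sumF-cong (λ k → solve 3 (λ a c v → a :* (c :* v) := c :* (a :* v)) refl (A i k) c (v k)))
                          (sym (*-distribˡ-sumF c (λ k → A i k * v k)))

  -ᴹ-⊛ : (A : Mat n) (v : Vect n) → ((-ᴹ A) ⊛ v) ≗ (λ i → - (A ⊛ v) i)
  -ᴹ-⊛ A v i = trans (sumF-cong (λ k → sym (ℚP.neg-distribˡ-* (A i k) (v k)))) (sym (neg-sumF (λ k → A i k * v k)))

  ⊗-cong : {A A′ B B′ : Mat n} → A ≐ A′ → B ≐ B′ → (A ⊗ B) ≐ (A′ ⊗ B′)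
  ⊗-cong A≐A′ B≐B′ i j = ⊛-cong A≐A′ (λ k → B≐B′ k j) i

  ⊗-congˡ : {A A′ : Mat n} (B : Mat n) → A ≐ A′ → (A ⊗ B) ≐ (A′ ⊗ B)
  ⊗-congˡ B A≐A′ = ⊗-cong A≐A′ (≐-refl {x = B})

  ⊗-congʳ : (A : Mat n) {B B′ : Mat n} → B ≐ B′ → (A ⊗ B) ≐ (A ⊗ B′)
  ⊗-congʳ A = ⊗-cong (≐-refl {x = A})

  ⊗-assoc : (A B C : Mat n) → ((A ⊗ B) ⊗ C) ≐ (A ⊗ (B ⊗ C))
  ⊗-assoc A B C i j = ⊛-assoc A B (λ k → C k j) i

  ⊗-identityˡ : (A : Mat n) → (idM ⊗ A) ≐ A
  ⊗-identityˡ A i j = ⊛-identityˡ (λ k → A k j) i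

  ⊗-identityʳ : (A : Mat n) → (A ⊗ idM) ≐ A
  ⊗-identityʳ A i j = sumF-δʳ (A i) j

  -ᴹ-⊗ˡ : (A B : Mat n) → ((-ᴹ A) ⊗ B) ≐ (-ᴹ (A ⊗ B))
  -ᴹ-⊗ˡ A B i j = -ᴹ-⊛ A (λ k → B k j) i

  -ᴹ-cong : {A B : Mat n} → A ≐ B → (-ᴹ A) ≐ (-ᴹ B)
  -ᴹ-cong A≐B i j = cong -_ (A≐B i j)

  transpose-⊗ : (A B : Mat n) → transpose (A ⊗ B) ≐ (transpose B ⊗ transpose A)
  transpose-⊗ A B i j = sumF-cong (λ k → ℚP.*-comm (A j k) (B k i))

  transpose-idM : transpose (idM {n}) ≐ idM
  transpose-idM i j = δ-sym j i

  ⊗-diag : (A : Mat n) (d : Vect n) → ∀ i j → (A ⊗ diag d) i j ≡ A i j * d j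
  ⊗-diag A d i j = trans (sumF-cong (λ k → sym (ℚP.*-assoc (A i k) (d k) (δ k j))))
                         (sumF-δʳ (λ k → A i k * d k) j)

  ⊗-diag-involutive : (A : Mat n) (d : Vect n) → (∀ j → d j * d j ≡ 1ℚ) → ((A ⊗ diag d) ⊗ diag d) ≐ A
  ⊗-diag-involutive A d d²≡1 i j = begin
    ((A ⊗ diag d) ⊗ diag d) i j  ≡⟨ ⊗-diag (A ⊗ diag d) d i j ⟩
    (A ⊗ diag d) i j * d j       ≡⟨ cong (_* d j) (⊗-diag A d i j) ⟩
    A i j * d j * d j            ≡⟨ ℚP.*-assoc (A i j) (d j) (d j) ⟩
    A i j * (d j * d j)          ≡⟨ cong (A i j *_) (d²≡1 j) ⟩
    A i j * 1ℚ                   ≡⟨ ℚP.*-identityʳ (A i j) ⟩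
    A i j                        ∎
    where open ≡-Reasoning

  ⊗-cancelʳ : {A B C R : Mat n} → (B ⊗ R) ≐ idM → (A ⊗ B) ≐ (C ⊗ B) → A ≐ C
  ⊗-cancelʳ {A} {B} {C} {R} B⊗R≐I A⊗B≐C⊗B = begin
    A              ≈⟨ ⊗-identityʳ A ⟨
    A ⊗ idM        ≈⟨ ⊗-congʳ A B⊗R≐I ⟨
    A ⊗ (B ⊗ R)    ≈⟨ ⊗-assoc A B R ⟨
    (A ⊗ B) ⊗ R    ≈⟨ ⊗-congˡ R A⊗B≐C⊗B ⟩
    (C ⊗ B) ⊗ R    ≈⟨ ⊗-assoc C B R ⟩
    C ⊗ (B ⊗ R)    ≈⟨ ⊗-congʳ C B⊗R≐I ⟩
    C ⊗ idM        ≈⟨ ⊗-identityʳ C ⟩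
    C              ∎
    where open ≐-Reasoning

  ⊛-cancelˡ : {B L : Mat n} {u v : Vect n} → (L ⊗ B) ≐ idM → (B ⊛ u) ≗ (B ⊛ v) → u ≗ v
  ⊛-cancelˡ {B} {L} {u} {v} L⊗B≐I Bu≗Bv i = begin
    u i                  ≡⟨ ⊛-identityˡ u i ⟨
    (idM ⊛ u) i          ≡⟨ ⊛-congˡ u L⊗B≐I i ⟨
    ((L ⊗ B) ⊛ u) i      ≡⟨ ⊛-assoc L B u i ⟩
    (L ⊛ (B ⊛ u)) i      ≡⟨ ⊛-congʳ L Bu≗Bv i ⟩
    (L ⊛ (B ⊛ v)) i      ≡⟨ ⊛-assoc L B v i ⟨
    ((L ⊗ B) ⊛ v) i      ≡⟨ ⊛-congˡ v L⊗B≐I i ⟩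
    (idM ⊛ v) i          ≡⟨ ⊛-identityˡ v i ⟩
    v i                  ∎
    where open ≡-Reasoning

  ⊗-cancelˡ : {A B C L : Mat n} → (L ⊗ B) ≐ idM → (B ⊗ A) ≐ (B ⊗ C) → A ≐ C
  ⊗-cancelˡ {A} {B} {C} {L} L⊗B≐I BA≐BC i j =
    ⊛-cancelˡ {B} {L} {λ k → A k j} {λ k → C k j} L⊗B≐I (λ k → BA≐BC k j) i

  transpose-inverse : {B R : Mat n} → (B ⊗ R) ≐ idM → (transpose R ⊗ transpose B) ≐ idM
  transpose-inverse {B} {R} B⊗R≐I = ≐-trans (≐-sym (transpose-⊗ B R)) (≐-trans (λ i j → B⊗R≐I j i) transpose-idM)

  congruence-injective : {B R X Y : Mat n} → (B ⊗ R) ≐ idM →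
                         (transpose B ⊗ (X ⊗ B)) ≐ (transpose B ⊗ (Y ⊗ B)) → X ≐ Y
  congruence-injective {B} {R} {X} {Y} B⊗R≐I BᵀXB≐BᵀYB =
    ⊗-cancelʳ {X} {B} {Y} {R} B⊗R≐I
      (⊗-cancelˡ {X ⊗ B} {transpose B} {Y ⊗ B} {transpose R} (transpose-inverse {B} {R} B⊗R≐I) BᵀXB≐BᵀYB)

  congruence-cong : (X : Mat n) {B C : Mat n} → B ≐ C → (transpose B ⊗ (X ⊗ B)) ≐ (transpose C ⊗ (X ⊗ C))
  congruence-cong X B≐C = ⊗-cong (λ i j → B≐C j i) (⊗-congʳ X B≐C)

  dot-congˡ : {x x′ : Vect n} (y : Vect n) → x ≗ x′ → dot x y ≡ dot x′ y
  dot-congˡ y x≗x′ = sumF-cong (λ k → cong (_* y k) (x≗x′ k))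

  dot-congʳ : (x : Vect n) {y y′ : Vect n} → y ≗ y′ → dot x y ≡ dot x y′
  dot-congʳ x y≗y′ = sumF-cong (λ k → cong (x k *_) (y≗y′ k))

  dot-comm : (x y : Vect n) → dot x y ≡ dot y x
  dot-comm x y = sumF-cong (λ k → ℚP.*-comm (x k) (y k))

  dot-*ˡ : (c : ℚ) (x y : Vect n) → dot (λ k → c * x k) y ≡ c * dot x y
  dot-*ˡ c x y = trans (sumF-cong (λ k → ℚP.*-assoc c (x k) (y k))) (sym (*-distribˡ-sumF c (λ k → x k * y k)))

  dot-⊛ : (x : Vect n) (A : Mat n) (y : Vect n) → dot x (A ⊛ y) ≡ dot (transpose A ⊛ x) y
  dot-⊛ x A y = begin
    sumF (λ k → x k * sumF (λ l → A k l * y l))    ≡⟨ sumF-cong (λ k → *-distribˡ-sumF (x k) (λ l → A k l * y l)) ⟩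
    sumF (λ k → sumF (λ l → x k * (A k l * y l)))  ≡⟨ sumF-comm (λ k l → x k * (A k l * y l)) ⟩
    sumF (λ l → sumF (λ k → x k * (A k l * y l)))  ≡⟨ sumF-cong (λ l → sumF-cong (λ k →
                                                        solve 3 (λ x a y → x :* (a :* y) := a :* x :* y) refl (x k) (A k l) (y l))) ⟩
    sumF (λ l → sumF (λ k → A k l * x k * y l))    ≡⟨ sumF-cong (λ l → *-distribʳ-sumF (y l) (λ k → A k l * x k)) ⟨
    sumF (λ l → sumF (λ k → A k l * x k) * y l)    ∎
    where open ≡-Reasoning

-- Orthogonal matrices

square-nonneg : ∀ p → 0ℚ ℚ.≤ p * p
square-nonneg p = ℚP.≤-trans (ℚP.0≤∣p∣ (p * p)) (ℚP.≤-reflexive (trans (ℚP.∣p*q∣≡∣p∣*∣q∣ p p) ∣p∣²≡p²))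
  where
  ∣p∣²≡p² : ℚ.∣ p ∣ * ℚ.∣ p ∣ ≡ p * p
  ∣p∣²≡p² with ℚP.∣p∣≡p∨∣p∣≡-p p
  ... | inj₁ ∣p∣≡p  = cong₂ _*_ ∣p∣≡p ∣p∣≡p
  ... | inj₂ ∣p∣≡-p = trans (cong₂ _*_ ∣p∣≡-p ∣p∣≡-p) (solve 1 (λ p → (:- p) :* (:- p) := p :* p) refl p)

square≡0 : ∀ p → p * p ≡ 0ℚ → p ≡ 0ℚ
square≡0 p p²≡0 with p ℚP.≟ 0ℚ
... | yes p≡0 = p≡0
... | no p≢0  = ⊥-elim (ℚP.1≢0 (begin
  1ℚ                     ≡⟨ cong₂ _*_ (ℚP.*-inverseʳ p) (ℚP.*-inverseʳ p) ⟨
  (p * p⁻¹) * (p * p⁻¹)  ≡⟨ solve 2 (λ p q → (p :* q) :* (p :* q) := (p :* p) :* (q :* q)) refl p p⁻¹ ⟩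
  (p * p) * (p⁻¹ * p⁻¹)  ≡⟨ cong (_* (p⁻¹ * p⁻¹)) p²≡0 ⟩
  0ℚ * (p⁻¹ * p⁻¹)       ≡⟨ ℚP.*-zeroˡ (p⁻¹ * p⁻¹) ⟩
  0ℚ                     ∎))
  where
  open ≡-Reasoning
  instance
    p≢0′ : ℚ.NonZero p
    p≢0′ = ℚ.≢-nonZero p≢0
  p⁻¹ : ℚ
  p⁻¹ = ℚ.1/ p

sumF-nonneg : ∀ {n} (f : Fin n → ℚ) → (∀ i → 0ℚ ℚ.≤ f i) → 0ℚ ℚ.≤ sumF f
sumF-nonneg {zero}  f f≥0 = ℚP.≤-refl
sumF-nonneg {suc n} f f≥0 = ℚP.+-mono-≤ (f≥0 zero) (sumF-nonneg (λ i → f (suc i)) (λ i → f≥0 (suc i)))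

nonneg-+≡0 : ∀ {a b} → 0ℚ ℚ.≤ a → 0ℚ ℚ.≤ b → a + b ≡ 0ℚ → a ≡ 0ℚ
nonneg-+≡0 {a} {b} a≥0 b≥0 a+b≡0 = ℚP.≤-antisym a≤0 a≥0
  where
  open ℚP.≤-Reasoning
  a≤0 : a ℚ.≤ 0ℚ
  a≤0 = begin
    a       ≡⟨ ℚP.+-identityʳ a ⟨
    a + 0ℚ  ≤⟨ ℚP.+-monoʳ-≤ a b≥0 ⟩
    a + b   ≡⟨ a+b≡0 ⟩
    0ℚ      ∎

sumF-nonneg-≡0 : ∀ {n} (f : Fin n → ℚ) → (∀ i → 0ℚ ℚ.≤ f i) → sumF f ≡ 0ℚ → ∀ i → f i ≡ 0ℚ
sumF-nonneg-≡0 f f≥0 Σf≡0 zero = nonneg-+≡0 (f≥0 zero) (sumF-nonneg (λ i → f (suc i)) (λ i → f≥0 (suc i))) Σf≡0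
sumF-nonneg-≡0 f f≥0 Σf≡0 (suc i) =
  sumF-nonneg-≡0 (λ i → f (suc i)) (λ i → f≥0 (suc i))
    (trans (sym (ℚP.+-identityˡ rest)) (trans (cong (_+ rest) (sym f₀≡0)) Σf≡0)) i
  where
  rest : ℚ
  rest = sumF (λ i → f (suc i))
  f₀≡0 : f zero ≡ 0ℚ
  f₀≡0 = sumF-nonneg-≡0 f f≥0 Σf≡0 zero

tr : ∀ {n} → Mat n → ℚ
tr A = sumF (λ i → A i i)

module _ {n : ℕ} where

  tr-cong : {A B : Mat n} → A ≐ B → tr A ≡ tr B
  tr-cong A≐B = sumF-cong (λ i → A≐B i i)

  tr-⊗-comm : (A B : Mat n) → tr (A ⊗ B) ≡ tr (B ⊗ A)
  tr-⊗-comm A B = trans (sumF-comm (λ i k → A i k * B k i)) (sumF-cong (λ k → sumF-cong (λ i → ℚP.*-comm (A i k) (B k i))))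

  tr-⊖ : (A B : Mat n) → tr (A ⊖ B) ≡ tr A - tr B
  tr-⊖ A B = sumF-- (λ i → A i i) (λ i → B i i)

  ⊖-⊗ : (A B C : Mat n) → ((A ⊖ B) ⊗ C) ≐ ((A ⊗ C) ⊖ (B ⊗ C))
  ⊖-⊗ A B C i j = trans (sumF-cong (λ k → solve 3 (λ a b c → (a :- b) :* c := a :* c :- b :* c) refl (A i k) (B i k) (C k j)))
                        (sumF-- (λ k → A i k * C k j) (λ k → B i k * C k j))

  ⊗-⊖ : (A B C : Mat n) → (A ⊗ (B ⊖ C)) ≐ ((A ⊗ B) ⊖ (A ⊗ C))
  ⊗-⊖ A B C i j = trans (sumF-cong (λ k → solve 3 (λ a b c → a :* (b :- c) := a :* b :- a :* c) refl (A i k) (B k j) (C k j)))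
                        (sumF-- (λ k → A i k * B k j) (λ k → A i k * C k j))

  ⊖-cong : {A A′ B B′ : Mat n} → A ≐ A′ → B ≐ B′ → (A ⊖ B) ≐ (A′ ⊖ B′)
  ⊖-cong A≐A′ B≐B′ i j = cong₂ _-_ (A≐A′ i j) (B≐B′ i j)

  tr-gram≡0 : (A : Mat n) → tr (transpose A ⊗ A) ≡ 0ℚ → ∀ i j → A i j ≡ 0ℚ
  tr-gram≡0 A trAᵀA≡0 i j = square≡0 (A i j)
    (sumF-nonneg-≡0 (λ i → A i j * A i j) (λ i → square-nonneg (A i j))
      (sumF-nonneg-≡0 (λ j → sumF (λ i → A i j * A i j)) (λ j → sumF-nonneg _ (λ i → square-nonneg (A i j))) trAᵀA≡0 j) i)

  -- E = I - QQᵀ is a symmetric idempotent of trace 0, so Σᵢⱼ Eᵢⱼ² = tr (EᵀE) = tr E = 0.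
  orthogonal-transpose : (Q : Mat n) → Orthogonal Q → Orthogonal (transpose Q)
  orthogonal-transpose Q QᵀQ≐I i j = sym (x∙y⁻¹≈ε⇒x≈y (δ i j) (Π i j) (E≐0 i j))
    where
    I Π E : Mat n
    I = idM
    Π = Q ⊗ transpose Q
    E = I ⊖ Π

    Π-idempotent : (Π ⊗ Π) ≐ Π
    Π-idempotent = begin
      (Q ⊗ transpose Q) ⊗ Π          ≈⟨ ⊗-assoc Q (transpose Q) Π ⟩
      Q ⊗ (transpose Q ⊗ Π)          ≈⟨ ⊗-congʳ Q (⊗-assoc (transpose Q) Q (transpose Q)) ⟨
      Q ⊗ ((transpose Q ⊗ Q) ⊗ transpose Q)  ≈⟨ ⊗-congʳ Q (⊗-congˡ (transpose Q) QᵀQ≐I) ⟩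
      Q ⊗ (I ⊗ transpose Q)          ≈⟨ ⊗-congʳ Q (⊗-identityˡ (transpose Q)) ⟩
      Π                              ∎
      where open ≐-Reasoning

    E-idempotent : (E ⊗ E) ≐ E
    E-idempotent = begin
      (I ⊖ Π) ⊗ E                ≈⟨ ⊖-⊗ I Π E ⟩
      (I ⊗ E) ⊖ (Π ⊗ (I ⊖ Π))    ≈⟨ ⊖-cong (⊗-identityˡ E) (⊗-⊖ Π I Π) ⟩
      E ⊖ ((Π ⊗ I) ⊖ (Π ⊗ Π))    ≈⟨ ⊖-cong (≐-refl {x = E}) (⊖-cong (⊗-identityʳ Π) Π-idempotent) ⟩
      E ⊖ (Π ⊖ Π)                ≈⟨ (λ a b → solve 2 (λ e p → e :- (p :- p) := e) refl (E a b) (Π a b)) ⟩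
      E                          ∎
      where open ≐-Reasoning

    E-symmetric : transpose E ≐ E
    E-symmetric a b = cong₂ _-_ (δ-sym b a) (sumF-cong (λ k → ℚP.*-comm (Q b k) (Q a k)))

    trE≡0 : tr (transpose E ⊗ E) ≡ 0ℚ
    trE≡0 = begin
      tr (transpose E ⊗ E)   ≡⟨ tr-cong (≐-trans (⊗-congˡ E E-symmetric) E-idempotent) ⟩
      tr E                   ≡⟨ tr-⊖ I Π ⟩
      tr I - tr Π            ≡⟨ cong (λ t → tr I - t) (trans (tr-⊗-comm Q (transpose Q)) (tr-cong QᵀQ≐I)) ⟩
      tr I - tr I            ≡⟨ ℚP.+-inverseʳ (tr I) ⟩
      0ℚ                     ∎
      where open ≡-Reasoning

    E≐0 : ∀ a b → E a b ≡ 0ℚ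
    E≐0 = tr-gram≡0 E trE≡0

-- Determinants

minor : ∀ {n} → Mat (suc n) → Fin (suc n) → Fin (suc n) → Mat n
minor A i j a b = A (punchIn i a) (punchIn j b)

det-cong : ∀ {n} {A B : Mat n} → A ≐ B → det A ≡ det B
det-cong {zero}  A≐B = refl
det-cong {suc n} A≐B = sumF-cong (λ j → cong₂ (λ a d → sgn j * (a * d)) (A≐B zero j)
                                                 (det-cong (λ a b → A≐B (suc a) (punchIn j b))))

-- Expanding twice, both sides become the double sum over i, j of ± A (i+1) 0 · A 0 (j+1) times
-- the minor without rows 0, i+1 and columns 0, j+1; the signs agree because
-- sgn (i+1) sgn j = sgn i sgn (j+1).
det-transpose : ∀ n (A : Mat n) → det (transpose A) ≡ det A
det-transpose zero          A = refl
det-transpose (suc zero)    A = refl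
det-transpose (suc (suc m)) A = begin
  det (transpose A)
    ≡⟨ sumF-cong (λ i → cong (λ d → sgn i * (A i zero * d)) (det-transpose (suc m) (minor A i zero))) ⟩
  t₀ + sumF (λ i → sgn (suc i) * (A (suc i) zero * det (minor A (suc i) zero)))
    ≡⟨ cong (t₀ +_) (trans (sumF-cong expand-column) (sumF-comm term)) ⟩
  t₀ + sumF (λ j → sumF (λ i → term i j))
    ≡⟨ cong (t₀ +_) (sumF-cong expand-row) ⟨
  t₀ + sumF (λ j → sgn (suc j) * (A zero (suc j) * det (transpose (minor A zero (suc j)))))
    ≡⟨ cong (t₀ +_) (sumF-cong (λ j → cong (λ d → sgn (suc j) * (A zero (suc j) * d))
                                            (det-transpose (suc m) (minor A zero (suc j))))) ⟩
  t₀ + sumF (λ j → sgn (suc j) * (A zero (suc j) * det (minor A zero (suc j))))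
    ∎
  where
  open ≡-Reasoning
  t₀ : ℚ
  t₀ = 1ℚ * (A zero zero * det (minor A zero zero))
  N : Fin (suc m) → Fin (suc m) → Mat m
  N i j a b = A (suc (punchIn i a)) (suc (punchIn j b))
  term : Fin (suc m) → Fin (suc m) → ℚ
  term i j = - (sgn i * sgn j * (A (suc i) zero * A zero (suc j) * det (N i j)))

  expand-column : ∀ i → sgn (suc i) * (A (suc i) zero * det (minor A (suc i) zero)) ≡ sumF (term i)
  expand-column i = trans (*-distribˡ-sumF² (sgn (suc i)) (A (suc i) zero) (λ j → sgn j * (A zero (suc j) * det (N i j))))
                          (sumF-cong λ j →
    trans (cong (λ s → s * (A (suc i) zero * (sgn j * (A zero (suc j) * det (N i j))))) (sign-suc (toℕ' i)))
          (solve 5 (λ s t a b d → (:- s) :* (a :* (t :* (b :* d))) := :- (s :* t :* (a :* b :* d))) refl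
                 (sgn i) (sgn j) (A (suc i) zero) (A zero (suc j)) (det (N i j))))

  expand-row : ∀ j → sgn (suc j) * (A zero (suc j) * det (transpose (minor A zero (suc j)))) ≡ sumF (λ i → term i j)
  expand-row j = begin
    sgn (suc j) * (A zero (suc j) * sumF (λ i → sgn i * (A (suc i) zero * det (transpose (N i j)))))
      ≡⟨ *-distribˡ-sumF² (sgn (suc j)) (A zero (suc j)) (λ i → sgn i * (A (suc i) zero * det (transpose (N i j)))) ⟩
    sumF (λ i → sgn (suc j) * (A zero (suc j) * (sgn i * (A (suc i) zero * det (transpose (N i j))))))
      ≡⟨ sumF-cong (λ i → cong₂ (λ s d → s * (A zero (suc j) * (sgn i * (A (suc i) zero * d))))
                                (sign-suc (toℕ' j)) (det-transpose m (N i j))) ⟩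
    sumF (λ i → (- sgn j) * (A zero (suc j) * (sgn i * (A (suc i) zero * det (N i j)))))
      ≡⟨ sumF-cong (λ i → solve 5 (λ s t a b d → (:- t) :* (b :* (s :* (a :* d))) := :- (s :* t :* (a :* b :* d))) refl
                                 (sgn i) (sgn j) (A (suc i) zero) (A zero (suc j)) (det (N i j))) ⟩
    sumF (λ i → term i j)  ∎

expansion-neg : ∀ {n} (s a d : Fin n → ℚ) → sumF (λ j → s j * (a j * - d j)) ≡ - sumF (λ j → s j * (a j * d j))
expansion-neg s a d = trans (sumF-cong (λ j → solve 3 (λ s a d → s :* (a :* (:- d)) := :- (s :* (a :* d))) refl (s j) (a j) (d j)))
                            (sym (neg-sumF (λ j → s j * (a j * d j))))

-- swapAdjacent k exchanges inject₁ k and suc k.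
swapAdjacent : ∀ {n} → Fin n → Fin (suc n) → Fin (suc n)
swapAdjacent zero    zero          = suc zero
swapAdjacent zero    (suc zero)    = zero
swapAdjacent zero    (suc (suc a)) = suc (suc a)
swapAdjacent (suc k) zero          = zero
swapAdjacent (suc k) (suc a)       = suc (swapAdjacent k a)

swapAdjacent₀-punchIn : ∀ {n} (k : Fin (suc n)) (b : Fin (suc (suc n))) →
  swapAdjacent zero (punchIn (suc (suc k)) b) ≡ punchIn (suc (suc k)) (swapAdjacent zero b)
swapAdjacent₀-punchIn k zero          = refl
swapAdjacent₀-punchIn k (suc zero)    = refl
swapAdjacent₀-punchIn k (suc (suc b)) = refl

det-swap-columns₀ : ∀ n (A : Mat (suc (suc n))) → det (λ a b → A a (swapAdjacent zero b)) ≡ - det A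

expansionFrom₂ : ∀ {n} → Mat (suc (suc n)) → ℚ
expansionFrom₂ A = sumF (λ k → sgn (suc (suc k)) * (A zero (suc (suc k)) * det (minor A zero (suc (suc k)))))

expansionFrom₂-swap-columns₀ : ∀ n (A : Mat (suc (suc n))) →
  expansionFrom₂ (λ a b → A a (swapAdjacent zero b)) ≡ - expansionFrom₂ A
expansionFrom₂-swap-columns₀ zero    A = refl
expansionFrom₂-swap-columns₀ (suc n) A = begin
  expansionFrom₂ (λ a b → A a (swapAdjacent zero b))
    ≡⟨ sumF-cong (λ k → cong (λ d → sgn (suc (suc k)) * (A zero (suc (suc k)) * d))
         (trans (det-cong (λ a b → cong (A (suc a)) (swapAdjacent₀-punchIn k b)))
                (det-swap-columns₀ n (minor A zero (suc (suc k)))))) ⟩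
  sumF (λ k → sgn (suc (suc k)) * (A zero (suc (suc k)) * - det (minor A zero (suc (suc k)))))
    ≡⟨ expansion-neg (λ k → sgn (suc (suc k))) (λ k → A zero (suc (suc k))) (λ k → det (minor A zero (suc (suc k)))) ⟩
  - expansionFrom₂ A  ∎
  where open ≡-Reasoning

det-swap-columns₀ n A = begin
  det A′
    ≡⟨ cong₂ (λ d₀ d₁ → 1ℚ * (A zero (suc zero) * d₀) + ((- 1ℚ) * (A zero zero * d₁) + expansionFrom₂ A′))
             (det-cong minor₀) (det-cong minor₁) ⟩
  1ℚ * t₁ + ((- 1ℚ) * t₀ + expansionFrom₂ A′)
    ≡⟨ cong (λ r → 1ℚ * t₁ + ((- 1ℚ) * t₀ + r)) (expansionFrom₂-swap-columns₀ n A) ⟩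
  1ℚ * t₁ + ((- 1ℚ) * t₀ + - expansionFrom₂ A)
    ≡⟨ solve 3 (λ a b r → con 1ℚ :* b :+ (con (- 1ℚ) :* a :+ :- r) := :- (con 1ℚ :* a :+ (con (- 1ℚ) :* b :+ r))) refl
             t₀ t₁ (expansionFrom₂ A) ⟩
  - det A  ∎
  where
  open ≡-Reasoning
  A′ : Mat (suc (suc n))
  A′ a b = A a (swapAdjacent zero b)
  t₀ t₁ : ℚ
  t₀ = A zero zero * det (minor A zero zero)
  t₁ = A zero (suc zero) * det (minor A zero (suc zero))
  minor₀ : minor A′ zero zero ≐ minor A zero (suc zero)
  minor₀ a zero    = refl
  minor₀ a (suc b) = refl
  minor₁ : minor A′ zero (suc zero) ≐ minor A zero zero
  minor₁ a zero    = refl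
  minor₁ a (suc b) = refl

det-swap-rows : ∀ {n} (k : Fin n) (A : Mat (suc n)) → det (λ a b → A (swapAdjacent k a) b) ≡ - det A
det-swap-rows {suc n} zero A = begin
  det (λ a b → A (swapAdjacent zero a) b)       ≡⟨ det-transpose (suc (suc n)) (λ a b → A (swapAdjacent zero a) b) ⟨
  det (λ a b → transpose A a (swapAdjacent zero b))  ≡⟨ det-swap-columns₀ n (transpose A) ⟩
  - det (transpose A)                           ≡⟨ cong -_ (det-transpose (suc (suc n)) A) ⟩
  - det A                                       ∎
  where open ≡-Reasoning
det-swap-rows (suc k) A = begin
  sumF (λ j → sgn j * (A zero j * det (λ a b → A (suc (swapAdjacent k a)) (punchIn j b))))
    ≡⟨ sumF-cong (λ j → cong (λ d → sgn j * (A zero j * d)) (det-swap-rows k (minor A zero j))) ⟩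
  sumF (λ j → sgn j * (A zero j * - det (minor A zero j)))
    ≡⟨ expansion-neg sgn (A zero) (λ j → det (minor A zero j)) ⟩
  - det A  ∎
  where open ≡-Reasoning

laplace : ∀ {n} → Mat (suc n) → Fin (suc n) → ℚ
laplace A i = sumF (λ j → sgn i * (sgn j * (A i j * det (minor A i j))))

toℕ'-inject₁ : ∀ {n} (k : Fin n) → toℕ' (Fin.inject₁ k) ≡ toℕ' k
toℕ'-inject₁ zero    = refl
toℕ'-inject₁ (suc k) = cong suc (toℕ'-inject₁ k)

swapAdjacent-inject₁ : ∀ {n} (k : Fin n) → swapAdjacent k (Fin.inject₁ k) ≡ suc k
swapAdjacent-inject₁ zero    = refl
swapAdjacent-inject₁ (suc k) = cong suc (swapAdjacent-inject₁ k)

swapAdjacent-punchIn-inject₁ : ∀ {n} (k a : Fin n) → swapAdjacent k (punchIn (Fin.inject₁ k) a) ≡ punchIn (suc k) a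
swapAdjacent-punchIn-inject₁ zero    zero    = refl
swapAdjacent-punchIn-inject₁ zero    (suc a) = refl
swapAdjacent-punchIn-inject₁ (suc k) zero    = refl
swapAdjacent-punchIn-inject₁ (suc k) (suc a) = cong suc (swapAdjacent-punchIn-inject₁ k a)

-- Row suc k is moved to position inject₁ k by one adjacent swap, which costs a sign.
det≡laplace : ∀ {n} (A : Mat (suc n)) (i : Fin (suc n)) → det A ≡ laplace A i
det≡laplace {n} A i = <-weakInduction (λ i → ∀ A → det A ≡ laplace A i) first-row next-row i A
  where
  first-row : ∀ A → det A ≡ laplace A zero
  first-row A = sumF-cong (λ j → sym (ℚP.*-identityˡ (sgn j * (A zero j * det (minor A zero j)))))

  next-row : ∀ k → (∀ A → det A ≡ laplace A (Fin.inject₁ k)) → ∀ A → det A ≡ laplace A (suc k)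
  next-row k ih A = ℚP.neg-injective (begin
    - det A
      ≡⟨ det-swap-rows k A ⟨
    det A′
      ≡⟨ ih A′ ⟩
    laplace A′ (Fin.inject₁ k)
      ≡⟨ sumF-cong (λ j → cong₂ (λ s r → s * (sgn j * r)) (cong sign (toℕ'-inject₁ k))
           (cong₂ _*_ (cong (λ r → A r j) (swapAdjacent-inject₁ k))
                      (det-cong (λ a b → cong (λ r → A r (punchIn j b)) (swapAdjacent-punchIn-inject₁ k a))))) ⟩
    sumF (λ j → sgn k * cofactorTerm j)
      ≡⟨ sumF-cong (λ j → solve 2 (λ s t → s :* t := :- ((:- s) :* t)) refl (sgn k) (cofactorTerm j)) ⟩
    sumF (λ j → - ((- sgn k) * cofactorTerm j))
      ≡⟨ neg-sumF (λ j → (- sgn k) * cofactorTerm j) ⟨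
    - sumF (λ j → (- sgn k) * cofactorTerm j)
      ≡⟨ cong (λ s → - sumF (λ j → s * cofactorTerm j)) (sign-suc (toℕ' k)) ⟨
    - laplace A (suc k)  ∎)
    where
    open ≡-Reasoning
    A′ : Mat (suc n)
    A′ a b = A (swapAdjacent k a) b
    cofactorTerm : Fin (suc n) → ℚ
    cofactorTerm j = sgn j * (A (suc k) j * det (minor A (suc k) j))

det-equal-rows : ∀ {n} (A : Mat n) (p q : Fin n) → p ≢ q → (∀ b → A p b ≡ A q b) → det A ≡ 0ℚ

private
  det-equal-rows-suc : ∀ {n} (A : Mat (suc n)) (p q : Fin n) → p ≢ q →
                       (∀ b → A (suc p) b ≡ A (suc q) b) → det A ≡ 0ℚ
  det-equal-rows-suc A p q p≢q rows≡ = sumF-zero λ j → begin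
    sgn j * (A zero j * det (minor A zero j))
      ≡⟨ cong (λ d → sgn j * (A zero j * d)) (det-equal-rows (minor A zero j) p q p≢q (λ b → rows≡ (punchIn j b))) ⟩
    sgn j * (A zero j * 0ℚ)
      ≡⟨ solve 2 (λ s a → s :* (a :* con 0ℚ) := con 0ℚ) refl (sgn j) (A zero j) ⟩
    0ℚ  ∎
    where open ≡-Reasoning

  det-equal-rows-zero : ∀ {n} (A : Mat (suc (suc n))) (q : Fin (suc n)) →
                        (∀ b → A zero b ≡ A (suc q) b) → det A ≡ 0ℚ
  det-equal-rows-zero A zero rows≡ = x≡-x⇒x≡0 (trans (det-cong A≐A′) (det-swap-rows zero A))
    where
    A≐A′ : A ≐ (λ a b → A (swapAdjacent zero a) b)
    A≐A′ zero          b = rows≡ b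
    A≐A′ (suc zero)    b = sym (rows≡ b)
    A≐A′ (suc (suc a)) b = refl
  det-equal-rows-zero {n} A (suc q) rows≡ = ℚP.neg-injective (begin
    - det A     ≡⟨ det-swap-rows zero A ⟨
    det A′      ≡⟨ det-equal-rows-suc A′ zero (suc q) (λ ()) rows≡ ⟩
    0ℚ          ∎)
    where
    open ≡-Reasoning
    A′ : Mat (suc (suc n))
    A′ a b = A (swapAdjacent zero a) b

det-equal-rows A zero    zero    p≢q rows≡ = ⊥-elim (p≢q refl)
det-equal-rows A (suc p) (suc q) p≢q rows≡ = det-equal-rows-suc A p q (λ p≡q → p≢q (cong suc p≡q)) rows≡
det-equal-rows {suc (suc n)} A zero    (suc q) p≢q rows≡ = det-equal-rows-zero A q rows≡
det-equal-rows {suc (suc n)} A (suc p) zero    p≢q rows≡ = det-equal-rows-zero A p (λ b → sym (rows≡ b))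

replaceRow : ∀ {n} → Mat n → Fin n → Vect n → Mat n
replaceRow A k r a b = if does (a Fin.≟ k) then r b else A a b

module _ {n : ℕ} (A : Mat n) (k : Fin n) (r : Vect n) where

  replaceRow-here : ∀ b → replaceRow A k r k b ≡ r b
  replaceRow-here b = cong (if_then r b else A k b) (dec-true (k Fin.≟ k) refl)

  replaceRow-there : ∀ {a} → a ≢ k → ∀ b → replaceRow A k r a b ≡ A a b
  replaceRow-there {a} a≢k b = cong (if_then r b else A a b) (dec-false (a Fin.≟ k) a≢k)

replaceRow-self : ∀ {n} (A : Mat n) (k : Fin n) → replaceRow A k (A k) ≐ A
replaceRow-self A k a b = by-cases (a Fin.≟ k)
  where
  by-cases : Dec (a ≡ k) → replaceRow A k (A k) a b ≡ A a b
  by-cases (yes refl) = replaceRow-here A k (A k) b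
  by-cases (no a≢k)   = replaceRow-there A k (A k) a≢k b

adjugate : ∀ {n} → Mat (suc n) → Mat (suc n)
adjugate A j k = sgn k * (sgn j * det (minor A k j))

-- Entry (i, k) of A · adj A is the expansion along row k of A with row k replaced by
-- row i; for i ≠ k that matrix has two equal rows.
⊗-adjugate : ∀ {n} (A : Mat (suc n)) → (A ⊗ adjugate A) ≐ scal (det A) idM
⊗-adjugate {n} A i k = begin
  sumF (λ j → A i j * (sgn k * (sgn j * det (minor A k j))))
    ≡⟨ sumF-cong (λ j → trans
         (solve 4 (λ a s t d → a :* (s :* (t :* d)) := s :* (t :* (a :* d))) refl (A i j) (sgn k) (sgn j) (det (minor A k j)))
         (cong₂ (λ a d → sgn k * (sgn j * (a * d))) (sym (replaceRow-here A k (A i) j))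
                (det-cong (λ a b → sym (replaceRow-there A k (A i) (FinP.punchInᵢ≢i k a) (punchIn j b)))))) ⟩
  laplace B k    ≡⟨ det≡laplace B k ⟨
  det B          ≡⟨ det-replaceRow (i Fin.≟ k) ⟩
  det A * δ i k  ∎
  where
  open ≡-Reasoning
  B : Mat (suc n)
  B = replaceRow A k (A i)
  det-replaceRow : Dec (i ≡ k) → det B ≡ det A * δ i k
  det-replaceRow (yes refl) = trans (det-cong (replaceRow-self A k))
                                    (sym (trans (cong (det A *_) (δ-refl k)) (ℚP.*-identityʳ (det A))))
  det-replaceRow (no i≢k)   = trans (det-equal-rows B i k i≢k rows≡)
                                    (sym (trans (cong (det A *_) (δ-≢ i≢k)) (ℚP.*-zeroʳ (det A))))
    where
    rows≡ : ∀ b → B i b ≡ B k b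
    rows≡ b = trans (replaceRow-there A k (A i) i≢k b) (sym (replaceRow-here A k (A i) b))

right-inverse : ∀ {n} (A : Mat n) → ¬ (det A ≡ 0ℚ) → Σ[ R ∈ Mat n ] (A ⊗ R) ≐ idM
right-inverse {zero}  A det≢0 = A , λ ()
right-inverse {suc n} A det≢0 = scal c (adjugate A) , λ i k → begin
  (A ⊛ (λ j → c * adjugate A j k)) i  ≡⟨ ⊛-scale A c (λ j → adjugate A j k) i ⟩
  c * (A ⊗ adjugate A) i k           ≡⟨ cong (c *_) (⊗-adjugate A i k) ⟩
  c * (det A * δ i k)                ≡⟨ ℚP.*-assoc c (det A) (δ i k) ⟨
  (c * det A) * δ i k                ≡⟨ cong (_* δ i k) (ℚP.*-inverseˡ (det A)) ⟩
  1ℚ * δ i k                         ≡⟨ ℚP.*-identityˡ (δ i k) ⟩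
  δ i k                              ∎
  where
  open ≡-Reasoning
  instance
    det≢0′ : ℚ.NonZero (det A)
    det≢0′ = ℚ.≢-nonZero det≢0
  c : ℚ
  c = ℚ.1/ det A

inverse : ∀ {n} (A : Mat n) → ¬ (det A ≡ 0ℚ) → Σ[ R ∈ Mat n ] ((A ⊗ R) ≐ idM × (R ⊗ A) ≐ idM)
inverse {n} A det≢0 with right-inverse A det≢0 | right-inverse (transpose A) detAᵀ≢0
  where
  detAᵀ≢0 : ¬ (det (transpose A) ≡ 0ℚ)
  detAᵀ≢0 detAᵀ≡0 = det≢0 (trans (sym (det-transpose n A)) detAᵀ≡0)
... | R , A⊗R≐I | R′ , Aᵀ⊗R′≐I =
  R , A⊗R≐I , ⊗-cancelˡ {A = R ⊗ A} {A} {idM} {transpose R′} (transpose-inverse {B = transpose A} Aᵀ⊗R′≐I) (begin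
  A ⊗ (R ⊗ A)   ≈⟨ ⊗-assoc A R A ⟨
  (A ⊗ R) ⊗ A   ≈⟨ ⊗-congˡ A A⊗R≐I ⟩
  idM ⊗ A       ≈⟨ ⊗-identityˡ A ⟩
  A             ≈⟨ ⊗-identityʳ A ⟨
  A ⊗ idM       ∎)
  where open ≐-Reasoning

≐-transpose⇒cospectral : ∀ {n} {A B : Mat n} → B ≐ transpose A → Cospectral A B
≐-transpose⇒cospectral {n} {A} {B} B≐Aᵀ t = sym (begin
  det (scal t idM ⊖ B)              ≡⟨ det-cong (λ i j → cong₂ (λ d b → t * d - b) (δ-sym i j) (B≐Aᵀ i j)) ⟩
  det (transpose (scal t idM ⊖ A))  ≡⟨ det-transpose n (scal t idM ⊖ A) ⟩
  det (scal t idM ⊖ A)              ∎)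
  where open ≡-Reasoning

-- Skew-symmetric matrices and Krylov vectors

Skew : ∀ {n} → Mat n → Set
Skew A = transpose A ≐ (-ᴹ A)

S-skew : ∀ {n} (Γ : OrientedGraph n) → Skew (S Γ)
S-skew Γ i j with arc Γ i j in ij | arc Γ j i in ji
... | true  | true  = ⊥-elim (false≢true (trans (sym (asym Γ i j ij)) ji))
  where
  false≢true : false ≢ true
  false≢true ()
... | true  | false = refl
... | false | true  = refl
... | false | false = refl

krylov : ∀ {n} → Mat n → Vect n → ℕ → Vect n
krylov A x m = (A ^^ m) ⊛ x

-- W Γ is krylovMatrix (S Γ) e by definition.
krylovMatrix : ∀ {n} → Mat n → Vect n → Mat n
krylovMatrix A x i k = krylov A x (toℕ' k) i

module _ {n : ℕ} (A : Mat n) (x : Vect n) where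

  krylov-zero : krylov A x 0 ≗ x
  krylov-zero = ⊛-identityˡ x

  krylov-suc : ∀ m → krylov A x (suc m) ≗ (A ⊛ krylov A x m)
  krylov-suc m = ⊛-assoc A (A ^^ m) x

  anticommuting-krylov : {M : Mat n} → (M ⊛ x) ≗ x → (M ⊗ A) ≐ (-ᴹ (A ⊗ M)) →
                         ∀ m → (M ⊛ krylov A x m) ≗ (λ i → sign m * krylov A x m i)
  anticommuting-krylov {M} Mx≗x MA≐-AM zero i = begin
    (M ⊛ krylov A x 0) i     ≡⟨ ⊛-congʳ M krylov-zero i ⟩
    (M ⊛ x) i                ≡⟨ Mx≗x i ⟩
    x i                      ≡⟨ krylov-zero i ⟨
    krylov A x 0 i           ≡⟨ ℚP.*-identityˡ (krylov A x 0 i) ⟨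
    1ℚ * krylov A x 0 i      ∎
    where open ≡-Reasoning
  anticommuting-krylov {M} Mx≗x MA≐-AM (suc m) i = begin
    (M ⊛ krylov A x (suc m)) i         ≡⟨ ⊛-congʳ M (krylov-suc m) i ⟩
    (M ⊛ (A ⊛ u)) i                    ≡⟨ ⊛-assoc M A u i ⟨
    ((M ⊗ A) ⊛ u) i                    ≡⟨ ⊛-congˡ u MA≐-AM i ⟩
    ((-ᴹ (A ⊗ M)) ⊛ u) i               ≡⟨ -ᴹ-⊛ (A ⊗ M) u i ⟩
    - ((A ⊗ M) ⊛ u) i                  ≡⟨ cong -_ (⊛-assoc A M u i) ⟩
    - (A ⊛ (M ⊛ u)) i                  ≡⟨ cong -_ (⊛-congʳ A (anticommuting-krylov Mx≗x MA≐-AM m) i) ⟩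
    - (A ⊛ (λ j → sign m * u j)) i     ≡⟨ cong -_ (⊛-scale A (sign m) u i) ⟩
    - (sign m * (A ⊛ u) i)             ≡⟨ cong (λ v → - (sign m * v)) (krylov-suc m i) ⟨
    - (sign m * krylov A x (suc m) i)  ≡⟨ ℚP.neg-distribˡ-* (sign m) (krylov A x (suc m) i) ⟩
    (- sign m) * krylov A x (suc m) i  ≡⟨ cong (_* krylov A x (suc m) i) (sign-suc m) ⟨
    sign (suc m) * krylov A x (suc m) i ∎
    where
    open ≡-Reasoning
    u : Vect n
    u = krylov A x m

module _ {n : ℕ} {A : Mat n} (A-skew : Skew A) where

  dot-skew : (x y : Vect n) → dot x (A ⊛ y) ≡ - dot (A ⊛ x) y
  dot-skew x y = begin
    dot x (A ⊛ y)                     ≡⟨ dot-⊛ x A y ⟩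
    dot (transpose A ⊛ x) y           ≡⟨ dot-congˡ y (⊛-congˡ x A-skew) ⟩
    dot ((-ᴹ A) ⊛ x) y                ≡⟨ dot-congˡ y (-ᴹ-⊛ A x) ⟩
    sumF (λ k → - (A ⊛ x) k * y k)    ≡⟨ sumF-cong (λ k → ℚP.neg-distribˡ-* ((A ⊛ x) k) (y k)) ⟨
    sumF (λ k → - ((A ⊛ x) k * y k))  ≡⟨ neg-sumF (λ k → (A ⊛ x) k * y k) ⟨
    - dot (A ⊛ x) y                   ∎
    where open ≡-Reasoning

  dot-skew-self : (x : Vect n) → dot x (A ⊛ x) ≡ 0ℚ
  dot-skew-self x = x≡-x⇒x≡0 (trans (dot-skew x x) (cong -_ (dot-comm (A ⊛ x) x)))

  module _ (x : Vect n) where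

    private
      u : ℕ → Vect n
      u = krylov A x

    dot-krylov-suc : ∀ i j → dot (u i) (u (suc j)) ≡ - dot (u (suc i)) (u j)
    dot-krylov-suc i j = begin
      dot (u i) (u (suc j))      ≡⟨ dot-congʳ (u i) (krylov-suc A x j) ⟩
      dot (u i) (A ⊛ u j)        ≡⟨ dot-skew (u i) (u j) ⟩
      - dot (A ⊛ u i) (u j)      ≡⟨ cong -_ (dot-congˡ (u j) (krylov-suc A x i)) ⟨
      - dot (u (suc i)) (u j)    ∎
      where open ≡-Reasoning

    ParityCompatible : ℕ → ℕ → Set
    ParityCompatible i j = dot (u i) (u j) ≡ 0ℚ ⊎ sign i ≡ sign j

    -- Moving A across the inner product flips the sign, so ⟨Aⁱx, Aʲx⟩ = ± ⟨Aᵈx, Aᵈ⁺¹x⟩ = 0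
    -- whenever i + j = 2d + 1 is odd.
    krylov-parity-from : ∀ d r → ParityCompatible r (d ℕ.+ r)
    krylov-parity-from zero          r = inj₂ refl
    krylov-parity-from (suc zero)    r =
      inj₁ (trans (dot-congʳ (u r) (krylov-suc A x r)) (dot-skew-self (u r)))
    krylov-parity-from (suc (suc d)) r with krylov-parity-from d (suc r)
    ... | inj₁ orthogonal = inj₁ (begin
      dot (u r) (u (suc (suc d ℕ.+ r)))   ≡⟨ cong (λ m → dot (u r) (u (suc m))) (ℕP.+-suc d r) ⟨
      dot (u r) (u (suc (d ℕ.+ suc r)))   ≡⟨ dot-krylov-suc r (d ℕ.+ suc r) ⟩
      - dot (u (suc r)) (u (d ℕ.+ suc r)) ≡⟨ cong -_ orthogonal ⟩
      0ℚ                                ∎)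
      where open ≡-Reasoning
    ... | inj₂ same-sign = inj₂ (ℚP.neg-injective (begin
      - sign r             ≡⟨ sign-suc r ⟨
      sign (suc r)         ≡⟨ same-sign ⟩
      sign (d ℕ.+ suc r)     ≡⟨ cong sign (ℕP.+-suc d r) ⟩
      sign (suc (d ℕ.+ r))   ≡⟨ sign-suc (d ℕ.+ r) ⟩
      - sign (d ℕ.+ r)       ∎))
      where open ≡-Reasoning

    krylov-parity : ∀ i j → ParityCompatible i j
    krylov-parity i j with ℕP.≤-total i j
    ... | inj₁ i≤j = subst (ParityCompatible i) (ℕP.m∸n+n≡m i≤j) (krylov-parity-from (j ℕ.∸ i) i)
    ... | inj₂ j≤i with subst (ParityCompatible j) (ℕP.m∸n+n≡m j≤i) (krylov-parity-from (i ℕ.∸ j) j)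
    ...   | inj₁ orthogonal = inj₁ (trans (dot-comm (u i) (u j)) orthogonal)
    ...   | inj₂ same-sign  = inj₂ (sym same-sign)

    krylov-sign : ∀ i j → sign i * dot (u i) (u j) ≡ sign j * dot (u i) (u j)
    krylov-sign i j with krylov-parity i j
    ... | inj₁ orthogonal = trans (cong (sign i *_) orthogonal) (trans (ℚP.*-zeroʳ (sign i))
                                  (sym (trans (cong (sign j *_) orthogonal) (ℚP.*-zeroʳ (sign j)))))
    ... | inj₂ same-sign  = cong (_* dot (u i) (u j)) same-sign

-- The converse matrix

module Converse {n : ℕ} {A : Mat n} (A-skew : Skew A) (x : Vect n)
                (det≢0 : ¬ (det (krylovMatrix A x) ≡ 0ℚ)) where

  private
    K R D : Mat n
    K = krylovMatrix A x
    R = proj₁ (inverse K det≢0)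
    D = diag sgn

    u : ℕ → Vect n
    u = krylov A x

    K⊗R≐I : (K ⊗ R) ≐ idM
    K⊗R≐I = proj₁ (proj₂ (inverse K det≢0))

    R⊗K≐I : (R ⊗ K) ≐ idM
    R⊗K≐I = proj₂ (proj₂ (inverse K det≢0))

  Q₀ : Mat n
  Q₀ = (K ⊗ D) ⊗ R

  Q₀⊗K : (Q₀ ⊗ K) ≐ (K ⊗ D)
  Q₀⊗K = begin
    ((K ⊗ D) ⊗ R) ⊗ K   ≈⟨ ⊗-assoc (K ⊗ D) R K ⟩
    (K ⊗ D) ⊗ (R ⊗ K)   ≈⟨ ⊗-congʳ (K ⊗ D) R⊗K≐I ⟩
    (K ⊗ D) ⊗ idM       ≈⟨ ⊗-identityʳ (K ⊗ D) ⟩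
    K ⊗ D               ∎
    where open ≐-Reasoning

  Q₀-column : ∀ k → (Q₀ ⊛ u (toℕ' k)) ≗ (λ i → sgn k * u (toℕ' k) i)
  Q₀-column k i = trans (Q₀⊗K i k) (trans (⊗-diag K sgn i k) (ℚP.*-comm (K i k) (sgn k)))

  gram-K⊗D : (transpose (K ⊗ D) ⊗ (K ⊗ D)) ≐ (transpose K ⊗ K)
  gram-K⊗D i j = begin
    sumF (λ l → (K ⊗ D) l i * (K ⊗ D) l j)
      ≡⟨ sumF-cong (λ l → cong₂ _*_ (⊗-diag K sgn l i) (⊗-diag K sgn l j)) ⟩
    sumF (λ l → (K l i * sgn i) * (K l j * sgn j))
      ≡⟨ sumF-cong (λ l → solve 4 (λ a s b t → (a :* s) :* (b :* t) := s :* (t :* (a :* b))) refl (K l i) (sgn i) (K l j) (sgn j)) ⟩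
    sumF (λ l → sgn i * (sgn j * (K l i * K l j)))
      ≡⟨ *-distribˡ-sumF² (sgn i) (sgn j) (λ l → K l i * K l j) ⟨
    sgn i * (sgn j * G)
      ≡⟨ cong (sgn i *_) (krylov-sign A-skew x (toℕ' i) (toℕ' j)) ⟨
    sgn i * (sgn i * G)
      ≡⟨ ℚP.*-assoc (sgn i) (sgn i) G ⟨
    (sgn i * sgn i) * G
      ≡⟨ cong (_* G) (sign-sq (toℕ' i)) ⟩
    1ℚ * G
      ≡⟨ ℚP.*-identityˡ G ⟩
    G  ∎
    where
    open ≡-Reasoning
    G : ℚ
    G = dot (u (toℕ' i)) (u (toℕ' j))

  Q₀-orthogonal : Orthogonal Q₀
  Q₀-orthogonal = congruence-injective {B = K} {R} {transpose Q₀ ⊗ Q₀} {idM} K⊗R≐I (begin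
    transpose K ⊗ ((transpose Q₀ ⊗ Q₀) ⊗ K)    ≈⟨ ⊗-congʳ (transpose K) (⊗-assoc (transpose Q₀) Q₀ K) ⟩
    transpose K ⊗ (transpose Q₀ ⊗ (Q₀ ⊗ K))    ≈⟨ ⊗-assoc (transpose K) (transpose Q₀) (Q₀ ⊗ K) ⟨
    (transpose K ⊗ transpose Q₀) ⊗ (Q₀ ⊗ K)    ≈⟨ ⊗-congˡ (Q₀ ⊗ K) (transpose-⊗ Q₀ K) ⟨
    transpose (Q₀ ⊗ K) ⊗ (Q₀ ⊗ K)              ≈⟨ ⊗-cong (λ i j → Q₀⊗K j i) Q₀⊗K ⟩
    transpose (K ⊗ D) ⊗ (K ⊗ D)                ≈⟨ gram-K⊗D ⟩
    transpose K ⊗ K                            ≈⟨ ⊗-congʳ (transpose K) (⊗-identityˡ K) ⟨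
    transpose K ⊗ (idM ⊗ K)                    ∎)
    where open ≐-Reasoning

  Q₀-involutive : (Q₀ ⊗ Q₀) ≐ idM
  Q₀-involutive = begin
    Q₀ ⊗ ((K ⊗ D) ⊗ R)   ≈⟨ ⊗-assoc Q₀ (K ⊗ D) R ⟨
    (Q₀ ⊗ (K ⊗ D)) ⊗ R   ≈⟨ ⊗-congˡ R Q₀⊗K⊗D ⟩
    K ⊗ R                ≈⟨ K⊗R≐I ⟩
    idM                  ∎
    where
    open ≐-Reasoning
    Q₀⊗K⊗D : (Q₀ ⊗ (K ⊗ D)) ≐ K
    Q₀⊗K⊗D = begin
      Q₀ ⊗ (K ⊗ D)    ≈⟨ ⊗-assoc Q₀ K D ⟨
      (Q₀ ⊗ K) ⊗ D    ≈⟨ ⊗-congˡ D Q₀⊗K ⟩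
      (K ⊗ D) ⊗ D     ≈⟨ ⊗-diag-involutive K sgn (λ j → sign-sq (toℕ' j)) ⟩
      K               ∎

  Q₀-symmetric : transpose Q₀ ≐ Q₀
  Q₀-symmetric = begin
    transpose Q₀                 ≈⟨ ⊗-identityʳ (transpose Q₀) ⟨
    transpose Q₀ ⊗ idM           ≈⟨ ⊗-congʳ (transpose Q₀) Q₀-involutive ⟨
    transpose Q₀ ⊗ (Q₀ ⊗ Q₀)     ≈⟨ ⊗-assoc (transpose Q₀) Q₀ Q₀ ⟨
    (transpose Q₀ ⊗ Q₀) ⊗ Q₀     ≈⟨ ⊗-congˡ Q₀ Q₀-orthogonal ⟩
    idM ⊗ Q₀                     ≈⟨ ⊗-identityˡ Q₀ ⟩
    Q₀                           ∎
    where open ≐-Reasoning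

  -- Kᵀ is injective, so compare inner products with the columns Sⁱx of K: Q₀ is symmetric and
  -- scales Sⁱx by (-1)ⁱ, which by parity is (-1)ⁿ whenever ⟨Sⁱx, Sⁿx⟩ ≠ 0.
  Q₀-krylov-last : (Q₀ ⊛ u n) ≗ (λ i → sign n * u n i)
  Q₀-krylov-last = ⊛-cancelˡ {B = transpose K} {L = transpose R} (transpose-inverse {B = K} {R = R} K⊗R≐I) λ i → begin
    dot (u (toℕ' i)) (Q₀ ⊛ u n)                     ≡⟨ dot-⊛ (u (toℕ' i)) Q₀ (u n) ⟩
    dot (transpose Q₀ ⊛ u (toℕ' i)) (u n)           ≡⟨ dot-congˡ (u n) (⊛-congˡ (u (toℕ' i)) Q₀-symmetric) ⟩
    dot (Q₀ ⊛ u (toℕ' i)) (u n)                     ≡⟨ dot-congˡ (u n) (Q₀-column i) ⟩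
    dot (λ k → sgn i * u (toℕ' i) k) (u n)          ≡⟨ dot-*ˡ (sgn i) (u (toℕ' i)) (u n) ⟩
    sgn i * dot (u (toℕ' i)) (u n)                  ≡⟨ krylov-sign A-skew x (toℕ' i) n ⟩
    sign n * dot (u (toℕ' i)) (u n)                 ≡⟨ ⊛-scale (transpose K) (sign n) (u n) i ⟨
    (transpose K ⊛ (λ k → sign n * u n k)) i        ∎
    where open ≡-Reasoning

  Q₀-krylov : ∀ m → m ℕ.≤ n → (Q₀ ⊛ u m) ≗ (λ i → sign m * u m i)
  Q₀-krylov m m≤n with ℕP.m≤n⇒m<n∨m≡n m≤n
  ... | inj₂ refl = Q₀-krylov-last
  ... | inj₁ m<n  = subst (λ m → (Q₀ ⊛ u m) ≗ (λ i → sign m * u m i))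
                          (trans (toℕ'≡toℕ (Fin.fromℕ< m<n)) (FinP.toℕ-fromℕ< m<n))
                          (Q₀-column (Fin.fromℕ< m<n))

  Q₀-anticommutes : (Q₀ ⊗ A) ≐ (-ᴹ (A ⊗ Q₀))
  Q₀-anticommutes = ⊗-cancelʳ K⊗R≐I λ i k → begin
    ((Q₀ ⊗ A) ⊗ K) i k                          ≡⟨ ⊗-assoc Q₀ A K i k ⟩
    (Q₀ ⊛ (λ l → (A ⊛ u (toℕ' k)) l)) i         ≡⟨ ⊛-congʳ Q₀ (krylov-suc A x (toℕ' k)) i ⟨
    (Q₀ ⊛ u (suc (toℕ' k))) i                   ≡⟨ Q₀-krylov (suc (toℕ' k)) (toℕ'<n k) i ⟩
    sign (suc (toℕ' k)) * u (suc (toℕ' k)) i     ≡⟨ cong₂ _*_ (sign-suc (toℕ' k)) (krylov-suc A x (toℕ' k) i) ⟩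
    (- sgn k) * (A ⊛ u (toℕ' k)) i              ≡⟨ ℚP.neg-distribˡ-* (sgn k) _ ⟨
    - (sgn k * (A ⊛ u (toℕ' k)) i)              ≡⟨ cong -_ (⊛-scale A (sgn k) (u (toℕ' k)) i) ⟨
    - (A ⊛ (λ l → sgn k * u (toℕ' k) l)) i      ≡⟨ cong -_ (⊛-congʳ A (Q₀-column k) i) ⟨
    - (A ⊛ (Q₀ ⊛ u (toℕ' k))) i                 ≡⟨ cong -_ (⊛-assoc A Q₀ (u (toℕ' k)) i) ⟨
    - ((A ⊗ Q₀) ⊛ u (toℕ' k)) i                 ≡⟨ -ᴹ-⊛ (A ⊗ Q₀) (u (toℕ' k)) i ⟨
    ((-ᴹ (A ⊗ Q₀)) ⊗ K) i k                     ∎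
    where open ≡-Reasoning

  Q₀-conj : (transpose Q₀ ⊗ (A ⊗ Q₀)) ≐ (-ᴹ A)
  Q₀-conj = begin
    transpose Q₀ ⊗ (A ⊗ Q₀)    ≈⟨ ⊗-congˡ (A ⊗ Q₀) Q₀-symmetric ⟩
    Q₀ ⊗ (A ⊗ Q₀)              ≈⟨ ⊗-assoc Q₀ A Q₀ ⟨
    (Q₀ ⊗ A) ⊗ Q₀              ≈⟨ ⊗-congˡ Q₀ Q₀-anticommutes ⟩
    (-ᴹ (A ⊗ Q₀)) ⊗ Q₀         ≈⟨ -ᴹ-⊗ˡ (A ⊗ Q₀) Q₀ ⟩
    -ᴹ ((A ⊗ Q₀) ⊗ Q₀)         ≈⟨ -ᴹ-cong (⊗-assoc A Q₀ Q₀) ⟩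
    -ᴹ (A ⊗ (Q₀ ⊗ Q₀))         ≈⟨ -ᴹ-cong (⊗-congʳ A Q₀-involutive) ⟩
    -ᴹ (A ⊗ idM)               ≈⟨ -ᴹ-cong (⊗-identityʳ A) ⟩
    -ᴹ A                       ∎
    where open ≐-Reasoning

  Q₀-regular : (Q₀ ⊛ x) ≗ x
  Q₀-regular i = begin
    (Q₀ ⊛ x) i          ≡⟨ ⊛-congʳ Q₀ (krylov-zero A x) i ⟨
    (Q₀ ⊛ u 0) i        ≡⟨ Q₀-krylov 0 ℕ.z≤n i ⟩
    1ℚ * u 0 i          ≡⟨ ℚP.*-identityˡ (u 0 i) ⟩
    u 0 i               ≡⟨ krylov-zero A x i ⟩
    x i                 ∎
    where open ≡-Reasoning

  Q₀-unique : ∀ Q → Orthogonal Q → (Q ⊛ x) ≗ x → (transpose Q ⊗ (A ⊗ Q)) ≐ (-ᴹ A) → Q ≐ Q₀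
  Q₀-unique Q QᵀQ≐I Qx≗x QᵀAQ≐-A i j = trans (Qᵀ≐Q₀ j i) (Q₀-symmetric i j)
    where
    Qᵀ : Mat n
    Qᵀ = transpose Q

    Qᵀx≗x : (Qᵀ ⊛ x) ≗ x
    Qᵀx≗x i = begin
      (Qᵀ ⊛ x) i          ≡⟨ ⊛-congʳ Qᵀ Qx≗x i ⟨
      (Qᵀ ⊛ (Q ⊛ x)) i    ≡⟨ ⊛-assoc Qᵀ Q x i ⟨
      ((Qᵀ ⊗ Q) ⊛ x) i    ≡⟨ ⊛-congˡ x QᵀQ≐I i ⟩
      (idM ⊛ x) i         ≡⟨ ⊛-identityˡ x i ⟩
      x i                 ∎
      where open ≡-Reasoning

    Qᵀ-anticommutes : (Qᵀ ⊗ A) ≐ (-ᴹ (A ⊗ Qᵀ))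
    Qᵀ-anticommutes = begin
      Qᵀ ⊗ A                ≈⟨ ⊗-identityʳ (Qᵀ ⊗ A) ⟨
      (Qᵀ ⊗ A) ⊗ idM        ≈⟨ ⊗-congʳ (Qᵀ ⊗ A) (orthogonal-transpose Q QᵀQ≐I) ⟨
      (Qᵀ ⊗ A) ⊗ (Q ⊗ Qᵀ)   ≈⟨ ⊗-assoc (Qᵀ ⊗ A) Q Qᵀ ⟨
      ((Qᵀ ⊗ A) ⊗ Q) ⊗ Qᵀ   ≈⟨ ⊗-congˡ Qᵀ (≐-trans (⊗-assoc Qᵀ A Q) QᵀAQ≐-A) ⟩
      (-ᴹ A) ⊗ Qᵀ           ≈⟨ -ᴹ-⊗ˡ A Qᵀ ⟩
      -ᴹ (A ⊗ Qᵀ)           ∎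
      where open ≐-Reasoning

    Qᵀ≐Q₀ : Qᵀ ≐ Q₀
    Qᵀ≐Q₀ = ⊗-cancelʳ K⊗R≐I λ i k →
      trans (anticommuting-krylov A x Qᵀx≗x Qᵀ-anticommutes (toℕ' k) i) (sym (Q₀-column k i))

converse-genCospectral : ∀ {n} (Γ : OrientedGraph n) → GenCospectral Γ (converse Γ)
converse-genCospectral Γ =
  ≐-transpose⇒cospectral {A = S Γ} (λ i j → refl) ,
  ≐-transpose⇒cospectral {A = (allOnesM ⊖ idM) ⊖ S Γ} (λ i j → cong (λ d → (1ℚ - d) - S Γ j i) (δ-sym i j))

proposition2p1 : (n : ℕ) (Γ : OrientedGraph n) → ¬ (det (W Γ) ≡ 0ℚ) →
    Σ (Mat n) (λ Q₀ →
      (InQ Γ Q₀ × ((transpose Q₀ ⊗ (S Γ ⊗ Q₀)) ≐ S (converse Γ))) ×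
      (∀ Q → InQ Γ Q → ((transpose Q ⊗ (S Γ ⊗ Q)) ≐ S (converse Γ)) → Q ≐ Q₀) ×
      (¬ SelfConverse Γ → ¬ IsPermutationMatrix Q₀))
proposition2p1 n Γ detW≢0 =
  Q₀ , ((Q₀-orthogonal , Q₀-regular , converse Γ , converse-genCospectral Γ , Q₀-conj′) , Q₀-conj′) ,
  Q₀-unique′ , not-permutation
  where
  open Converse (S-skew Γ) e detW≢0

  -- S (converse Γ) is transpose (S Γ) by definition, so S-skew Γ relates it to -ᴹ S Γ.
  Q₀-conj′ : (transpose Q₀ ⊗ (S Γ ⊗ Q₀)) ≐ S (converse Γ)
  Q₀-conj′ = ≐-trans Q₀-conj (≐-sym (S-skew Γ))

  Q₀-unique′ : ∀ Q → InQ Γ Q → (transpose Q ⊗ (S Γ ⊗ Q)) ≐ S (converse Γ) → Q ≐ Q₀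
  Q₀-unique′ Q (Q-orthogonal , Q-regular , _) Q-conj =
    Q₀-unique Q Q-orthogonal Q-regular (≐-trans Q-conj (S-skew Γ))

  not-permutation : ¬ SelfConverse Γ → ¬ IsPermutationMatrix Q₀
  not-permutation ¬self-converse (σ , Q₀≐σ) =
    ¬self-converse (σ , ≐-trans (congruence-cong (S Γ) (≐-sym Q₀≐σ)) Q₀-conj′)
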